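{- Let $G$ be a connected bipartite graph with at least two vertices. Then $G$ is $\alpha$-stable if and only if $G$ has a perfect matching and the intersection of all perfect matchings of $G$ is empty.
   Context: All graphs are finite and simple. $\alpha(G)$ is the largest size of a stable set. $G$ is $\alpha^-$-stable if $\alpha(G-e)=\alpha(G)$ for every edge $e$; $\alpha^+$-stable if $\alpha(G+e)=\alpha(G)$ for every pair $e=xy$ of distinct nonadjacent vertices; $\alpha$-stable if both. A perfect matching is a set of pairwise non-incident edges covering all vertices; perfect matchings are viewed as edge sets. -}

module Defs where

open import Data.Nat using (ℕ; _≤_)
open import Data.Bool using (Bool; true; false; if_then_else_; _∨_; _∧_)
open import Data.Fin using (Fin)
open import Data.Fin.Properties using (_≟_)
open import Data.Fin.Subset using (Subset; _∈_; ∣_∣)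
open import Data.Product using (Σ; _×_; ∃; _,_)
open import Data.Empty using (⊥)
open import Relation.Nullary using (¬_; does; yes; no)
open import Relation.Binary.PropositionalEquality using (_≡_; _≢_)

record Graph (n : ℕ) : Set where
  field
    Adj   : Fin n → Fin n → Bool
    sym   : ∀ u v → Adj u v ≡ Adj v u
    irref : ∀ u → Adj u u ≡ false
open Graph public

Edge : ∀ {n} → Graph n → Fin n → Fin n → Set
Edge G u v = Adj G u v ≡ true

samePair : ∀ {n} → Fin n → Fin n → Fin n → Fin n → Bool
samePair x y u v = (does (u ≟ x) ∧ does (v ≟ y)) ∨ (does (u ≟ y) ∧ does (v ≟ x))

deleteEdge : ∀ {n} (G : Graph n) (x y : Fin n) → Edge G x y → Graph n
deleteEdge {n} G x y _ = record
  { Adj = λ u v → if samePair x y u v then false else Adj G u v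
  ; sym = symP
  ; irref = irP }
  where
  open import Data.Bool.Properties using (∨-comm)
  open import Relation.Binary.PropositionalEquality using (refl; cong₂)
  swap : ∀ u v → samePair x y u v ≡ samePair x y v u
  swap u v with u ≟ x | v ≟ y | u ≟ y | v ≟ x
  ... | yes _ | yes _ | yes _ | yes _ = refl
  ... | yes _ | yes _ | yes _ | no _ = refl
  ... | yes _ | yes _ | no _ | yes _ = refl
  ... | yes _ | yes _ | no _ | no _ = refl
  ... | yes _ | no _ | yes _ | yes _ = refl
  ... | yes _ | no _ | yes _ | no _ = refl
  ... | yes _ | no _ | no _ | yes _ = refl
  ... | yes _ | no _ | no _ | no _ = refl
  ... | no _ | yes _ | yes _ | yes _ = refl
  ... | no _ | yes _ | yes _ | no _ = refl
  ... | no _ | yes _ | no _ | yes _ = refl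
  ... | no _ | yes _ | no _ | no _ = refl
  ... | no _ | no _ | yes _ | yes _ = refl
  ... | no _ | no _ | yes _ | no _ = refl
  ... | no _ | no _ | no _ | yes _ = refl
  ... | no _ | no _ | no _ | no _ = refl
  symP : ∀ u v → (if samePair x y u v then false else Adj G u v)
               ≡ (if samePair x y v u then false else Adj G v u)
  symP u v rewrite swap u v | Graph.sym G u v = refl
  irP : ∀ u → (if samePair x y u u then false else Adj G u u) ≡ false
  irP u with samePair x y u u
  ... | true = refl
  ... | false = Graph.irref G u

addEdge : ∀ {n} (G : Graph n) (x y : Fin n) → x ≢ y → Adj G x y ≡ false → Graph n
addEdge {n} G x y x≢y _ = record
  { Adj = λ u v → if samePair x y u v then true else Adj G u v
  ; sym = symP
  ; irref = irP }
  where
  open import Relation.Binary.PropositionalEquality using (refl; trans) renaming (sym to ≡sym)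
  open import Data.Empty using (⊥-elim)
  swap : ∀ u v → samePair x y u v ≡ samePair x y v u
  swap u v with u ≟ x | v ≟ y | u ≟ y | v ≟ x
  ... | yes _ | yes _ | yes _ | yes _ = refl
  ... | yes _ | yes _ | yes _ | no _ = refl
  ... | yes _ | yes _ | no _ | yes _ = refl
  ... | yes _ | yes _ | no _ | no _ = refl
  ... | yes _ | no _ | yes _ | yes _ = refl
  ... | yes _ | no _ | yes _ | no _ = refl
  ... | yes _ | no _ | no _ | yes _ = refl
  ... | yes _ | no _ | no _ | no _ = refl
  ... | no _ | yes _ | yes _ | yes _ = refl
  ... | no _ | yes _ | yes _ | no _ = refl
  ... | no _ | yes _ | no _ | yes _ = refl
  ... | no _ | yes _ | no _ | no _ = refl
  ... | no _ | no _ | yes _ | yes _ = refl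
  ... | no _ | no _ | yes _ | no _ = refl
  ... | no _ | no _ | no _ | yes _ = refl
  ... | no _ | no _ | no _ | no _ = refl
  symP : ∀ u v → (if samePair x y u v then true else Adj G u v)
               ≡ (if samePair x y v u then true else Adj G v u)
  symP u v rewrite swap u v | Graph.sym G u v = refl
  irP : ∀ u → (if samePair x y u u then true else Adj G u u) ≡ false
  irP u with u ≟ x | u ≟ y
  ... | yes p | yes q = ⊥-elim (x≢y (trans (≡sym p) q))
  ... | yes _ | no _ = Graph.irref G u
  ... | no _ | yes _ = Graph.irref G u
  ... | no _ | no _ = Graph.irref G u

Stable : ∀ {n} → Graph n → Subset n → Set
Stable G S = ∀ u v → u ∈ S → v ∈ S → Adj G u v ≡ false

IsAlpha : ∀ {n} → Graph n → ℕ → Set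
IsAlpha {n} G k = (Σ (Subset n) λ S → Stable G S × ∣ S ∣ ≡ k)
                × (∀ S → Stable G S → ∣ S ∣ ≤ k)

αMinusStable : ∀ {n} → Graph n → Set
αMinusStable G = ∀ x y (e : Edge G x y) k →
  IsAlpha G k → IsAlpha (deleteEdge G x y e) k

αPlusStable : ∀ {n} → Graph n → Set
αPlusStable G = ∀ x y (x≢y : x ≢ y) (ne : Adj G x y ≡ false) k →
  IsAlpha G k → IsAlpha (addEdge G x y x≢y ne) k

αStable : ∀ {n} → Graph n → Set
αStable G = αMinusStable G × αPlusStable G

data Walk {n} (G : Graph n) : Fin n → Fin n → Set where
  here : ∀ {u} → Walk G u u
  step : ∀ {u v w} → Edge G u v → Walk G v w → Walk G u w

Connected : ∀ {n} → Graph n → Set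
Connected G = ∀ u v → Walk G u v

Bipartite : ∀ {n} → Graph n → Set
Bipartite {n} G = Σ (Fin n → Bool) λ c → ∀ u v → Edge G u v → c u ≢ c v

IsPerfectMatching : ∀ {n} → Graph n → (Fin n → Fin n → Bool) → Set
IsPerfectMatching {n} G M =
    (∀ u v → M u v ≡ M v u)
  × (∀ u v → M u v ≡ true → Edge G u v)
  × (∀ u → ∃ λ v → M u v ≡ true)
  × (∀ u v w → M u v ≡ true → M u w ≡ true → v ≡ w)

HasPerfectMatching : ∀ {n} → Graph n → Set
HasPerfectMatching {n} G = Σ (Fin n → Fin n → Bool) (IsPerfectMatching G)

PMIntersectionEmpty : ∀ {n} → Graph n → Set
PMIntersectionEmpty {n} G = ∀ (u v : Fin n) →
  ¬ (∀ M → IsPerfectMatching G M → M u v ≡ true)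

module Submission where

-- By König's theorem, a bipartite graph has a matching m and a stable set S containing every
-- m-unmatched vertex and an end of every m-edge (found by the Hungarian augmenting-path search);
-- then α(G) = |S|, and every stable set missing an m-unmatched vertex is strictly smaller than S.
-- If G has a perfect matching, both colour classes are such sets S. Adding an edge xy keeps the
-- class avoiding x stable; deleting an edge missed by some perfect matching M keeps M perfect;
-- either way α does not change. Conversely, if the König matching misses a vertex z, rematch a
-- neighbour w of z to z: then mate(w) is unmatched, so every maximum stable set of G + z·mate(w)
-- contains both z and mate(w), which is absurd. If an edge uv lies in every perfect matching, the
-- König matching of G − uv cannot be perfect, and the colour class avoiding one of its unmatched
-- vertices shows α(G − uv) > α(G).

open import Defs hiding (sym)
open import Data.Bool using (Bool; true; false; not)
open import Data.Bool.Properties using (¬-not; not-¬; not-involutive) renaming (_≟_ to _≟ᵇ_)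
open import Data.Fin using (Fin; zero; suc)
open import Data.Fin.Properties using (_≟_; any?; suc-injective)
open import Data.Fin.Subset using (Subset; _∈_; _∉_; _⊂_; _⊃_; _∪_; _-_; ⁅_⁆; ∣_∣; inside; outside)
open import Data.Fin.Subset.Properties
  using (_∈?_; x∈p∧x≢y⇒x∈p-y; x∈p⇒∣p-x∣<∣p∣; p⊆p∪q; q⊆p∪q; x∈⁅x⁆; x∈⁅y⁆⇒x≡y; x∈p∪q⁻)
open import Data.Fin.Subset.Induction using (Acc; acc; ⊂-wellFounded; ⊃-wellFounded)
open import Data.List using (List; []; _∷_)
open import Data.List.Membership.Propositional using () renaming (_∈_ to _∈ₗ_; _∉_ to _∉ₗ_)
open import Data.List.Relation.Unary.All using (All; []; _∷_)
import Data.List.Relation.Unary.All as All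
open import Data.List.Relation.Unary.Any using (here; there)
open import Data.Nat using (suc; _≤_; _<_; z≤n; s≤s)
open import Data.Nat.Properties using (≤-<-trans; <⇒≱; ≤-antisym; ≤-reflexive; _≤?_)
open import Data.Product using (Σ-syntax; ∃; _×_; _,_; proj₁; proj₂)
import Data.Product as Product
import Data.Sum as Sum
open import Data.Sum using (_⊎_; inj₁; inj₂)
open import Data.Vec using ([]; _∷_; tabulate; here; there)
open import Data.Vec.Properties using (lookup∘tabulate; lookup⇒[]=; []=⇒lookup)
open import Function using (_∘_; id; flip; case_of_)
open import Function.Bundles using (_⇔_; mk⇔)
open import Relation.Nullary using (¬_; Dec; yes; no; does; contradiction)
open import Relation.Nullary.Decidable using (dec-true; decidable-stable; ¬?; _×-dec_; _⊎-dec_)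
open import Relation.Unary using (Pred; Decidable)
open import Relation.Binary.PropositionalEquality using (_≡_; _≢_; refl; sym; trans; cong; subst; module ≡-Reasoning)

dec-true⁻ : ∀ {a} {A : Set a} (a? : Dec A) → does a? ≡ true → A
dec-true⁻ (yes a) _ = a

subset : ∀ {n ℓ} {P : Pred (Fin n) ℓ} → Decidable P → Subset n
subset P? = tabulate (does ∘ P?)

module _ {n ℓ} {P : Pred (Fin n) ℓ} (P? : Decidable P) where

  ∈-subset⁺ : ∀ {x} → P x → x ∈ subset P?
  ∈-subset⁺ {x} px = lookup⇒[]= x _ (trans (lookup∘tabulate (does ∘ P?) x) (dec-true (P? x) px))

  ∈-subset⁻ : ∀ {x} → x ∈ subset P? → P x
  ∈-subset⁻ {x} x∈ = dec-true⁻ (P? x) (trans (sym (lookup∘tabulate (does ∘ P?) x)) ([]=⇒lookup x∈))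

injection⇒∣p∣≤∣q∣ : ∀ {m n} (p : Subset m) {q : Subset n} (f : Fin m → Fin n) →
  (∀ {x} → x ∈ p → f x ∈ q) → (∀ {x y} → x ∈ p → y ∈ p → f x ≡ f y → x ≡ y) → ∣ p ∣ ≤ ∣ q ∣
injection⇒∣p∣≤∣q∣ []            f into inj = z≤n
injection⇒∣p∣≤∣q∣ (outside ∷ p) f into inj =
  injection⇒∣p∣≤∣q∣ p (f ∘ suc) (λ x∈p → into (there x∈p))
    (λ x∈p y∈p fx≡fy → suc-injective (inj (there x∈p) (there y∈p) fx≡fy))
injection⇒∣p∣≤∣q∣ (inside ∷ p) f into inj =
  ≤-<-trans (injection⇒∣p∣≤∣q∣ p (f ∘ suc) into′ inj′) (x∈p⇒∣p-x∣<∣p∣ (into here))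
  where
  inj′ : ∀ {x y} → x ∈ p → y ∈ p → f (suc x) ≡ f (suc y) → x ≡ y
  inj′ x∈p y∈p = suc-injective ∘ inj (there x∈p) (there y∈p)
  into′ : ∀ {x} → x ∈ p → f (suc x) ∈ _ - f zero
  into′ x∈p = x∈p∧x≢y⇒x∈p-y (into (there x∈p)) (λ fx≡f0 → case inj here (there x∈p) (sym fx≡f0) of λ ())

ProperColouring : ∀ {n} → Graph n → (Fin n → Bool) → Set
ProperColouring G c = ∀ u v → Edge G u v → c u ≢ c v

x∉p⇒p⊂p∪⁅x⁆ : ∀ {n} {p : Subset n} {x} → x ∉ p → p ⊂ p ∪ ⁅ x ⁆
x∉p⇒p⊂p∪⁅x⁆ {p = p} {x} x∉p = p⊆p∪q ⁅ x ⁆ , x , q⊆p∪q p ⁅ x ⁆ (x∈⁅x⁆ x) , x∉p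

∃-other : ∀ {n} → 2 ≤ n → (z : Fin n) → ∃ λ v → z ≢ v
∃-other (s≤s (s≤s _)) zero    = suc zero , λ ()
∃-other (s≤s (s≤s _)) (suc z) = zero , λ ()

samePair-refl : ∀ {n} (x y : Fin n) → samePair x y x y ≡ true
samePair-refl x y rewrite dec-true (x ≟ x) refl | dec-true (y ≟ y) refl = refl

samePair⇒ : ∀ {n} (x y u v : Fin n) → samePair x y u v ≡ true → (u ≡ x × v ≡ y) ⊎ (u ≡ y × v ≡ x)
samePair⇒ x y u v h with u ≟ x | v ≟ y | u ≟ y | v ≟ x
... | yes u≡x | yes v≡y | _       | _       = inj₁ (u≡x , v≡y)
... | _       | _       | yes u≡y | yes v≡x = inj₂ (u≡y , v≡x)
... | no _    | _       | no _    | _       = case h of λ ()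
... | no _    | _       | yes _   | no _    = case h of λ ()
... | yes _   | no _    | no _    | _       = case h of λ ()
... | yes _   | no _    | yes _   | no _    = case h of λ ()

colourClass : ∀ {n} → (Fin n → Bool) → Bool → Subset n
colourClass c x = subset (λ v → c v ≟ᵇ x)

∉-colourClass-not : ∀ {n} (c : Fin n → Bool) v → v ∉ colourClass c (not (c v))
∉-colourClass-not c v v∈ = not-¬ refl (∈-subset⁻ (λ u → c u ≟ᵇ not (c v)) v∈)

module AddEdge {n} (G : Graph n) {x y : Fin n} (x≢y : x ≢ y) (x≁y : Adj G x y ≡ false) where

  G⁺ : Graph n
  G⁺ = addEdge G x y x≢y x≁y

  edge-xy : Edge G⁺ x y
  edge-xy rewrite samePair-refl x y = refl

  stable⇒¬xy : ∀ {S} → Stable G⁺ S → x ∈ S → y ∉ S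
  stable⇒¬xy S-stable x∈S y∈S = case trans (sym edge-xy) (S-stable x y x∈S y∈S) of λ ()

  stable⁻ : ∀ {S} → Stable G⁺ S → Stable G S
  stable⁻ S-stable u v u∈S v∈S with samePair x y u v | S-stable u v u∈S v∈S
  ... | false | u≁v = u≁v

  stable⁺ : ∀ {S} → Stable G S → x ∉ S → Stable G⁺ S
  stable⁺ S-stable x∉S u v u∈S v∈S with samePair x y u v in eq
  ... | false = S-stable u v u∈S v∈S
  ... | true with samePair⇒ x y u v eq
  ...   | inj₁ (refl , _) = contradiction u∈S x∉S
  ...   | inj₂ (_ , refl) = contradiction v∈S x∉S

module DeleteEdge {n} (G : Graph n) {x y : Fin n} (e : Edge G x y) where

  G⁻ : Graph n
  G⁻ = deleteEdge G x y e

  ¬edge-xy : ¬ Edge G⁻ x y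
  ¬edge-xy h rewrite samePair-refl x y = case h of λ ()

  edge⁻ : ∀ {u v} → Edge G⁻ u v → Edge G u v
  edge⁻ {u} {v} h with samePair x y u v
  ... | false = h

  stable⁺ : ∀ {S} → Stable G S → Stable G⁻ S
  stable⁺ S-stable u v u∈S v∈S with samePair x y u v
  ... | true  = refl
  ... | false = S-stable u v u∈S v∈S

  proper⁺ : ∀ {c} → ProperColouring G c → ProperColouring G⁻ c
  proper⁺ proper u v uv = proper u v (edge⁻ uv)

  isPerfectMatching⁻ : ∀ {M} → IsPerfectMatching G⁻ M → IsPerfectMatching G M
  isPerfectMatching⁻ (M-sym , M-edge , M-cover , M-unique) =
    M-sym , (λ u v uv∈M → edge⁻ (M-edge u v uv∈M)) , M-cover , M-unique

  isPerfectMatching⁺ : ∀ {M} → IsPerfectMatching G M → M x y ≡ false → IsPerfectMatching G⁻ M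
  isPerfectMatching⁺ {M} (M-sym , M-edge , M-cover , M-unique) xy∉M = M-sym , M-edge′ , M-cover , M-unique
    where
    M-edge′ : ∀ u v → M u v ≡ true → Edge G⁻ u v
    M-edge′ u v uv∈M with samePair x y u v in eq
    ... | false = M-edge u v uv∈M
    ... | true with samePair⇒ x y u v eq
    ...   | inj₁ (refl , refl) = case trans (sym uv∈M) xy∉M of λ ()
    ...   | inj₂ (refl , refl) = case trans (sym uv∈M) (trans (M-sym y x) xy∉M) of λ ()

module Matchings {n} (G : Graph n) where

  edge-sym : ∀ {u v} → Edge G u v → Edge G v u
  edge-sym {u} {v} e = trans (Graph.sym G v u) e

  edge⇒≢ : ∀ {u v} → Edge G u v → u ≢ v
  edge⇒≢ {u} e refl = case trans (sym e) (irref G u) of λ ()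

  stable⇒¬edge : ∀ {S u v} → Stable G S → u ∈ S → v ∈ S → ¬ Edge G u v
  stable⇒¬edge {u = u} {v} S-stable u∈S v∈S e = case trans (sym e) (S-stable u v u∈S v∈S) of λ ()

  proper-flip : ∀ {c} → ProperColouring G c → ∀ {u v x} → Edge G u v → c u ≡ x → c v ≡ not x
  proper-flip proper {u} {v} e cu≡x = trans (¬-not (λ cv≡cu → proper u v e (sym cv≡cu))) (cong not cu≡x)

  ¬edge⇒stable : ∀ {S} → (∀ {u v} → u ∈ S → v ∈ S → ¬ Edge G u v) → Stable G S
  ¬edge⇒stable no-edge u v u∈S v∈S with Adj G u v in uv
  ... | true  = contradiction uv (no-edge u∈S v∈S)
  ... | false = refl

  walk-first-edge : ∀ {u v} → Walk G u v → u ≢ v → ∃ (Edge G u)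
  walk-first-edge here         u≢u = contradiction refl u≢u
  walk-first-edge (step e _) _   = _ , e

  has-neighbour : 2 ≤ n → Connected G → ∀ z → ∃ (Edge G z)
  has-neighbour two connected z = walk-first-edge (connected z v) z≢v
    where
    v = proj₁ (∃-other two z)
    z≢v = proj₂ (∃-other two z)

  -- A matching is an involution along edges; its fixed points are the unmatched vertices.
  record Matching : Set where
    field
      mate            : Fin n → Fin n
      mate-involutive : ∀ v → mate (mate v) ≡ v
      mate-edge       : ∀ {v} → mate v ≢ v → Edge G v (mate v)
  open Matching public

  Unmatched Matched : Matching → Fin n → Set
  Unmatched m v = mate m v ≡ v
  Matched   m v = mate m v ≢ v

  Perfect : Matching → Set
  Perfect m = ∀ v → Matched m v

  unmatched : Matching → Subset n
  unmatched m = subset (λ v → mate m v ≟ v)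

  ∈-unmatched⁺ : ∀ {m v} → Unmatched m v → v ∈ unmatched m
  ∈-unmatched⁺ {m} = ∈-subset⁺ (λ v → mate m v ≟ v)

  ∈-unmatched⁻ : ∀ {m v} → v ∈ unmatched m → Unmatched m v
  ∈-unmatched⁻ {m} = ∈-subset⁻ (λ v → mate m v ≟ v)

  _⊑_ _⊏_ : Matching → Matching → Set
  m ⊑ m′ = ∀ {v} → Matched m v → Matched m′ v
  m ⊏ m′ = unmatched m′ ⊂ unmatched m

  empty : Matching
  empty = record
    { mate            = λ v → v
    ; mate-involutive = λ _ → refl
    ; mate-edge       = λ v≢v → contradiction refl v≢v }

  mate-injective : ∀ (m : Matching) {u v} → mate m u ≡ mate m v → u ≡ v
  mate-injective m {u} {v} eq = trans (sym (mate-involutive m u)) (trans (cong (mate m) eq) (mate-involutive m v))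

  ⊑⇒⊏ : ∀ {m m′ b} → m ⊑ m′ → Unmatched m b → Matched m′ b → m ⊏ m′
  ⊑⇒⊏ {m} {m′} {b} m⊑m′ b-unm b-mat =
    (λ {v} v∈ → ∈-unmatched⁺ {m} (decidable-stable (mate m v ≟ v) (λ v-mat → m⊑m′ v-mat (∈-unmatched⁻ {m′} v∈)))) ,
    b , ∈-unmatched⁺ {m} b-unm , (λ b∈ → b-mat (∈-unmatched⁻ {m′} b∈))

  mate-stable : ∀ (m : Matching) {T u v} → Stable G T → u ∈ T → v ∈ T → u ≡ mate m v → u ≡ v
  mate-stable m {T} {u} {v} T-stable u∈T v∈T u≡v′ with mate m v ≟ v
  ... | yes v-unm = trans u≡v′ v-unm
  ... | no  v-mat = contradiction (mate-edge m v-mat) (stable⇒¬edge T-stable v∈T (subst (_∈ T) u≡v′ u∈T))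

  fromPerfectMatching : ∀ {M} → IsPerfectMatching G M → Matching
  fromPerfectMatching (M-sym , M-edge , M-cover , M-unique) = record
    { mate            = λ u → proj₁ (M-cover u)
    ; mate-involutive = λ u → M-unique _ _ u (proj₂ (M-cover _)) (trans (M-sym _ u) (proj₂ (M-cover u)))
    ; mate-edge       = λ {u} _ → M-edge u _ (proj₂ (M-cover u)) }

  fromPerfectMatching-perfect : ∀ {M} (pm : IsPerfectMatching G M) → Perfect (fromPerfectMatching pm)
  fromPerfectMatching-perfect (_ , M-edge , M-cover , _) v v′≡v = edge⇒≢ (M-edge v _ (proj₂ (M-cover v))) (sym v′≡v)

  toRelation : Matching → Fin n → Fin n → Bool
  toRelation m u v = does (v ≟ mate m u)

  toRelation-isPerfectMatching : ∀ {m} → Perfect m → IsPerfectMatching G (toRelation m)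
  toRelation-isPerfectMatching {m} perfect = M-sym , M-edge , M-cover , M-unique
    where
    M-sym : ∀ u v → toRelation m u v ≡ toRelation m v u
    M-sym u v with v ≟ mate m u | u ≟ mate m v
    ... | yes _     | yes _    = refl
    ... | no  _     | no  _    = refl
    ... | yes v≡u′  | no  u≢v′ = contradiction (trans (sym (mate-involutive m u)) (cong (mate m) (sym v≡u′))) u≢v′
    ... | no  v≢u′  | yes u≡v′ = contradiction (trans (sym (mate-involutive m v)) (cong (mate m) (sym u≡v′))) v≢u′
    M-edge : ∀ u v → toRelation m u v ≡ true → Edge G u v
    M-edge u v uv∈M = subst (Edge G u) (sym (dec-true⁻ (v ≟ mate m u) uv∈M)) (mate-edge m (perfect u))
    M-cover : ∀ u → ∃ λ v → toRelation m u v ≡ true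
    M-cover u = mate m u , dec-true (mate m u ≟ mate m u) refl
    M-unique : ∀ u v w → toRelation m u v ≡ true → toRelation m u w ≡ true → v ≡ w
    M-unique u v w uv∈M uw∈M = trans (dec-true⁻ (v ≟ mate m u) uv∈M) (sym (dec-true⁻ (w ≟ mate m u) uw∈M))

  -- Such a pair certifies König's theorem: |S| = n − |m| = α(G).
  record KonigPair (m : Matching) (S : Subset n) : Set where
    field
      stable     : Stable G S
      unmatched∈ : ∀ {v} → Unmatched m v → v ∈ S
      covers     : ∀ {v} → Matched m v → v ∈ S ⊎ mate m v ∈ S

  module _ {m S} (kp : KonigPair m S) where
    open KonigPair kp

    representative : Fin n → Fin n
    representative u with u ∈? S
    ... | yes _ = u
    ... | no  _ = mate m u

    representative∈S : ∀ u → representative u ∈ S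
    representative∈S u with u ∈? S
    ... | yes u∈S = u∈S
    ... | no  u∉S with mate m u ≟ u
    ...   | yes u-unm = contradiction (unmatched∈ u-unm) u∉S
    ...   | no  u-mat with covers u-mat
    ...     | inj₁ u∈S  = contradiction u∈S u∉S
    ...     | inj₂ u′∈S = u′∈S

    representative-injective : ∀ {T} → Stable G T →
      ∀ {u v} → u ∈ T → v ∈ T → representative u ≡ representative v → u ≡ v
    representative-injective T-stable {u} {v} u∈T v∈T eq with u ∈? S | v ∈? S
    ... | yes _ | yes _ = eq
    ... | yes _ | no  _ = mate-stable m T-stable u∈T v∈T eq
    ... | no  _ | yes _ = sym (mate-stable m T-stable v∈T u∈T (sym eq))
    ... | no  _ | no  _ = mate-injective m eq

    representative≢unmatched : ∀ {T z u} → Unmatched m z → z ∉ T → u ∈ T → representative u ≢ z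
    representative≢unmatched {T} {z} {u} z-unm z∉T u∈T u*≡z with u ∈? S
    ... | yes _ = z∉T (subst (_∈ T) u*≡z u∈T)
    ... | no  _ = z∉T (subst (_∈ T) (mate-injective m (trans u*≡z (sym z-unm))) u∈T)

    konigPair-max : ∀ {T} → Stable G T → ∣ T ∣ ≤ ∣ S ∣
    konigPair-max T-stable =
      injection⇒∣p∣≤∣q∣ _ representative (λ {u} _ → representative∈S u) (representative-injective T-stable)

    konigPair-strict : ∀ {T z} → Stable G T → Unmatched m z → z ∉ T → ∣ T ∣ < ∣ S ∣
    konigPair-strict T-stable z-unm z∉T = ≤-<-trans
      (injection⇒∣p∣≤∣q∣ _ representative
        (λ {u} u∈T → x∈p∧x≢y⇒x∈p-y (representative∈S u) (representative≢unmatched z-unm z∉T u∈T))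
        (representative-injective T-stable))
      (x∈p⇒∣p-x∣<∣p∣ (unmatched∈ z-unm))

    konigPair-isAlpha : IsAlpha G ∣ S ∣
    konigPair-isAlpha = (S , stable , refl) , λ T T-stable → konigPair-max T-stable

    unmatched∈maximum : ∀ {T z} → Stable G T → ∣ S ∣ ≤ ∣ T ∣ → Unmatched m z → z ∈ T
    unmatched∈maximum {T} {z} T-stable ∣S∣≤∣T∣ z-unm =
      decidable-stable (z ∈? T) (λ z∉T → <⇒≱ (konigPair-strict T-stable z-unm z∉T) ∣S∣≤∣T∣)

  -- Trade the matching edge at a for ab, where b was unmatched; the former mate of a becomes unmatched.
  module Rematch (q : Matching) {a b : Fin n} (ab : Edge G a b) (b-unm : Unmatched q b) where

    a≢b : a ≢ b
    a≢b = edge⇒≢ ab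

    mate′ : Fin n → Fin n
    mate′ v with v ≟ a | v ≟ b | v ≟ mate q a
    ... | yes _ | _     | _     = b
    ... | no  _ | yes _ | _     = a
    ... | no  _ | no  _ | yes _ = v
    ... | no  _ | no  _ | no  _ = mate q v

    mate′-a : mate′ a ≡ b
    mate′-a with a ≟ a
    ... | yes _   = refl
    ... | no  a≢a = contradiction refl a≢a

    mate′-b : mate′ b ≡ a
    mate′-b with b ≟ a | b ≟ b
    ... | yes b≡a | _       = contradiction (sym b≡a) a≢b
    ... | no  _   | yes _   = refl
    ... | no  _   | no  b≢b = contradiction refl b≢b

    mate′-mate-a : Matched q a → mate′ (mate q a) ≡ mate q a
    mate′-mate-a a-mat with mate q a ≟ a | mate q a ≟ b | mate q a ≟ mate q a
    ... | yes a′≡a | _        | _       = contradiction a′≡a a-mat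
    ... | no  _    | yes a′≡b | _       = contradiction (mate-injective q (trans a′≡b (sym b-unm))) a≢b
    ... | no  _    | no  _    | yes _   = refl
    ... | no  _    | no  _    | no  ≢a′ = contradiction refl ≢a′

    mate′-other : ∀ {v} → v ≢ a → v ≢ b → v ≢ mate q a → mate′ v ≡ mate q v
    mate′-other {v} v≢a v≢b v≢a′ with v ≟ a | v ≟ b | v ≟ mate q a
    ... | yes v≡a | _       | _        = contradiction v≡a v≢a
    ... | no  _   | yes v≡b | _        = contradiction v≡b v≢b
    ... | no  _   | no  _   | yes v≡a′ = contradiction v≡a′ v≢a′
    ... | no  _   | no  _   | no  _    = refl

    data Position (v : Fin n) : Set where
      at-a      : v ≡ a → Position v
      at-b      : v ≡ b → Position v
      at-mate-a : Matched q a → v ≡ mate q a → Position v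
      elsewhere : v ≢ a → v ≢ b → v ≢ mate q a → Position v

    position : ∀ v → Position v
    position v with v ≟ a | v ≟ b | v ≟ mate q a
    ... | yes v≡a | _       | _        = at-a v≡a
    ... | no  _   | yes v≡b | _        = at-b v≡b
    ... | no  v≢a | no  _   | yes v≡a′ = at-mate-a (λ a′≡a → v≢a (trans v≡a′ a′≡a)) v≡a′
    ... | no  v≢a | no  v≢b | no  v≢a′ = elsewhere v≢a v≢b v≢a′

    mate′-involutive : ∀ v → mate′ (mate′ v) ≡ v
    mate′-involutive v with position v
    ... | at-a refl            = trans (cong mate′ mate′-a) mate′-b
    ... | at-b refl            = trans (cong mate′ mate′-b) mate′-a
    ... | at-mate-a a-mat refl = trans (cong mate′ (mate′-mate-a a-mat)) (mate′-mate-a a-mat)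
    ... | elsewhere v≢a v≢b v≢a′ = begin
      mate′ (mate′ v)   ≡⟨ cong mate′ (mate′-other v≢a v≢b v≢a′) ⟩
      mate′ (mate q v)  ≡⟨ mate′-other (λ v′≡a → v≢a′ (trans (sym (mate-involutive q v)) (cong (mate q) v′≡a)))
                                       (λ v′≡b → v≢b (trans (sym (mate-involutive q v)) (trans (cong (mate q) v′≡b) b-unm)))
                                       (v≢a ∘ mate-injective q) ⟩
      mate q (mate q v) ≡⟨ mate-involutive q v ⟩
      v                 ∎
      where open ≡-Reasoning

    mate′-edge : ∀ {v} → mate′ v ≢ v → Edge G v (mate′ v)
    mate′-edge {v} v′≢v with position v
    ... | at-a refl              = subst (Edge G a) (sym mate′-a) ab
    ... | at-b refl              = subst (Edge G b) (sym mate′-b) (edge-sym ab)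
    ... | at-mate-a a-mat refl   = contradiction (mate′-mate-a a-mat) v′≢v
    ... | elsewhere v≢a v≢b v≢a′ =
      subst (Edge G v) (sym (mate′-other v≢a v≢b v≢a′)) (mate-edge q (v′≢v ∘ trans (mate′-other v≢a v≢b v≢a′)))

    rematch : Matching
    rematch = record { mate = mate′ ; mate-involutive = mate′-involutive ; mate-edge = mate′-edge }

    rematch-b : Matched rematch b
    rematch-b b′≡b = a≢b (trans (sym mate′-b) b′≡b)

    rematch-matched : ∀ {v} → Matched q v → v ≢ mate q a → Matched rematch v
    rematch-matched {v} v-mat v≢a′ with position v
    ... | at-a refl              = λ a′≡a → a≢b (trans (sym a′≡a) mate′-a)
    ... | at-b refl              = contradiction b-unm v-mat
    ... | at-mate-a _ v≡a′       = contradiction v≡a′ v≢a′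
    ... | elsewhere v≢a v≢b v≢a′ = v-mat ∘ trans (sym (mate′-other v≢a v≢b v≢a′))

    rematch-konigPair : ∀ {S} → KonigPair q S → mate q a ∈ S → KonigPair rematch S
    rematch-konigPair {S} kp a′∈S = record { stable = stable ; unmatched∈ = unmatched∈′ ; covers = covers′ }
      where
      open KonigPair kp
      unmatched∈′ : ∀ {v} → Unmatched rematch v → v ∈ S
      unmatched∈′ {v} v-unm with position v
      ... | at-a refl              = contradiction (trans (sym mate′-a) v-unm) (a≢b ∘ sym)
      ... | at-b refl              = unmatched∈ b-unm
      ... | at-mate-a _ refl       = a′∈S
      ... | elsewhere v≢a v≢b v≢a′ = unmatched∈ (trans (sym (mate′-other v≢a v≢b v≢a′)) v-unm)
      covers′ : ∀ {v} → Matched rematch v → v ∈ S ⊎ mate′ v ∈ S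
      covers′ {v} v-mat with position v
      ... | at-a refl              = inj₂ (subst (_∈ S) (sym mate′-a) (unmatched∈ b-unm))
      ... | at-b refl              = inj₁ (unmatched∈ b-unm)
      ... | at-mate-a _ refl       = inj₁ a′∈S
      ... | elsewhere v≢a v≢b v≢a′ =
        Sum.map₂ (subst (_∈ S) (sym (mate′-other v≢a v≢b v≢a′)))
                 (covers (v-mat ∘ trans (mate′-other v≢a v≢b v≢a′)))

  data AlternatingPath (m : Matching) : Fin n → List (Fin n) → Set where
    root   : ∀ {a} → Unmatched m a → AlternatingPath m a (a ∷ [])
    extend : ∀ {a b vs} → AlternatingPath m a vs → Edge G a b → Matched m b → b ∉ₗ vs → mate m b ∉ₗ vs →
             AlternatingPath m (mate m b) (mate m b ∷ b ∷ vs)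

  augment : ∀ {m a b vs} → AlternatingPath m a vs → (q : Matching) → (∀ {v} → v ∈ₗ vs → mate q v ≡ mate m v) →
            Edge G a b → Unmatched q b → b ∉ₗ vs → Σ[ q′ ∈ Matching ] q ⊑ q′ × Matched q′ b
  augment {a = a} (root a-unm) q agree ab b-unm _ = rematch , (λ v-mat → rematch-matched v-mat (v≢a v-mat)) , rematch-b
    where
    open Rematch q ab b-unm
    a-unm′ : Unmatched q a
    a-unm′ = trans (agree (here refl)) a-unm
    v≢a : ∀ {v} → Matched q v → v ≢ mate q a
    v≢a v-mat v≡a′ = v-mat (subst (Unmatched q) (sym (trans v≡a′ a-unm′)) a-unm′)
  augment {m} (extend {b = b₀} {vs₀} P a₀b₀ b₀-mat b₀∉vs₀ a∉vs₀) q agree ab b-unm b∉vs = q′ , q⊑q′ , r⊑q′ rematch-b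
    where
    open Rematch q ab b-unm
    a′≡b₀ : mate q (mate m b₀) ≡ b₀
    a′≡b₀ = trans (agree (here refl)) (mate-involutive m b₀)
    a-mat : Matched q (mate m b₀)
    a-mat a′≡a = b₀-mat (sym (trans (sym a′≡b₀) a′≡a))
    b₀-unm : Unmatched rematch b₀
    b₀-unm = subst (λ v → mate′ v ≡ v) a′≡b₀ (mate′-mate-a a-mat)
    agree′ : ∀ {v} → v ∈ₗ vs₀ → mate′ v ≡ mate m v
    agree′ {v} v∈vs₀ = trans
      (mate′-other (λ v≡a → a∉vs₀ (subst (_∈ₗ vs₀) v≡a v∈vs₀))
                   (λ v≡b → b∉vs (there (there (subst (_∈ₗ vs₀) v≡b v∈vs₀))))
                   (λ v≡a′ → b₀∉vs₀ (subst (_∈ₗ vs₀) (trans v≡a′ a′≡b₀) v∈vs₀)))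
      (agree (there (there v∈vs₀)))
    improved = augment P rematch agree′ a₀b₀ b₀-unm b₀∉vs₀
    q′ = proj₁ improved
    r⊑q′ = proj₁ (proj₂ improved)
    q⊑q′ : q ⊑ q′
    q⊑q′ {v} v-mat with v ≟ b₀
    ... | yes refl = proj₂ (proj₂ improved)
    ... | no  v≢b₀ = r⊑q′ (rematch-matched v-mat (v≢b₀ ∘ flip trans a′≡b₀))

  module Hungarian {c : Fin n → Bool} (proper : ProperColouring G c) (m : Matching) where

    Reached : Subset n → Fin n → Set
    Reached L v = v ∈ L ⊎ mate m v ∈ L

    RootedPath : Subset n → Fin n → Set
    RootedPath L a = Σ[ vs ∈ List (Fin n) ] AlternatingPath m a vs × All (Reached L) vs

    ∉path : ∀ {L vs v} → All (Reached L) vs → v ∉ L → mate m v ∉ L → v ∉ₗ vs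
    ∉path reached v∉L v′∉L v∈vs = Sum.[ v∉L , v′∉L ] (All.lookup reached v∈vs)

    -- L is the left side (colour true) of a Hungarian forest: the vertices reachable from unmatched
    -- left vertices by alternating paths, each recorded together with its vertices.
    record Forest (L : Subset n) : Set where
      field
        left  : ∀ {a} → a ∈ L → c a ≡ true
        roots : ∀ {a} → c a ≡ true → Unmatched m a → a ∈ L
        path  : ∀ {a} → a ∈ L → RootedPath L a

    unmatchedLeft? : Decidable (λ a → c a ≡ true × Unmatched m a)
    unmatchedLeft? a = (c a ≟ᵇ true) ×-dec (mate m a ≟ a)

    initialForest : Forest (subset unmatchedLeft?)
    initialForest = record
      { left  = proj₁ ∘ ∈-subset⁻ unmatchedLeft?
      ; roots = λ ca a-unm → ∈-subset⁺ unmatchedLeft? (ca , a-unm)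
      ; path  = λ {a} a∈ → a ∷ [] , root (proj₂ (∈-subset⁻ unmatchedLeft? a∈)) , inj₁ a∈ ∷ [] }

    Frontier : Subset n → Set
    Frontier L = ∃ λ a → ∃ λ b → a ∈ L × Edge G a b × mate m b ∉ L

    frontier? : ∀ L → Dec (Frontier L)
    frontier? L = any? λ a → any? λ b → (a ∈? L) ×-dec (Adj G a b ≟ᵇ true) ×-dec ¬? (mate m b ∈? L)

    inCover? : ∀ L → Decidable (λ v → (c v ≡ true × v ∈ L) ⊎ (c v ≡ false × mate m v ∉ L))
    inCover? L v = ((c v ≟ᵇ true) ×-dec (v ∈? L)) ⊎-dec ((c v ≟ᵇ false) ×-dec ¬? (mate m v ∈? L))

    module _ {L} (F : Forest L) where
      open Forest F

      right : ∀ {a b} → a ∈ L → Edge G a b → c b ≡ false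
      right a∈L ab = proper-flip proper ab (left a∈L)

      right∉ : ∀ {a b} → a ∈ L → Edge G a b → b ∉ L
      right∉ a∈L ab b∈L = case trans (sym (left b∈L)) (right a∈L ab) of λ ()

      forest-augment : ∀ {a b} → a ∈ L → Edge G a b → Unmatched m b → ∃ (m ⊏_)
      forest-augment a∈L ab b-unm with path a∈L
      ... | vs , P , reached = q , ⊑⇒⊏ {m} {q} m⊑q b-unm b-mat
        where
        b∉L = right∉ a∈L ab
        improved = augment P m (λ _ → refl) ab b-unm (∉path reached b∉L (subst (_∉ L) (sym b-unm) b∉L))
        q = proj₁ improved
        m⊑q = proj₁ (proj₂ improved)
        b-mat = proj₂ (proj₂ improved)

      forest-extend : ∀ {a b} → a ∈ L → Edge G a b → Matched m b → mate m b ∉ L → Forest (L ∪ ⁅ mate m b ⁆)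
      forest-extend {a} {b} a∈L ab b-mat b′∉L = record
        { left = left′ ; roots = λ ca a-unm → L⊆L′ (roots ca a-unm) ; path = path′ }
        where
        L′ = L ∪ ⁅ mate m b ⁆
        L⊆L′ : ∀ {x} → x ∈ L → x ∈ L′
        L⊆L′ = p⊆p∪q ⁅ mate m b ⁆
        b′∈L′ : mate m b ∈ L′
        b′∈L′ = q⊆p∪q L ⁅ mate m b ⁆ (x∈⁅x⁆ (mate m b))
        b∉L = right∉ a∈L ab
        weaken : ∀ {vs} → All (Reached L) vs → All (Reached L′) vs
        weaken = All.map (Sum.map L⊆L′ L⊆L′)
        left′ : ∀ {x} → x ∈ L′ → c x ≡ true
        left′ x∈L′ with x∈p∪q⁻ L ⁅ mate m b ⁆ x∈L′
        ... | inj₁ x∈L    = left x∈L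
        ... | inj₂ x∈⁅b′⁆ with refl ← x∈⁅y⁆⇒x≡y _ x∈⁅b′⁆ = proper-flip proper (mate-edge m b-mat) (right a∈L ab)
        path′ : ∀ {x} → x ∈ L′ → RootedPath L′ x
        path′ x∈L′ with x∈p∪q⁻ L ⁅ mate m b ⁆ x∈L′
        ... | inj₁ x∈L    = Product.map₂ (Product.map₂ weaken) (path x∈L)
        ... | inj₂ x∈⁅b′⁆ with refl ← x∈⁅y⁆⇒x≡y _ x∈⁅b′⁆ with path a∈L
        ...   | vs , P , reached =
          mate m b ∷ b ∷ vs ,
          extend P ab b-mat (∉path reached b∉L b′∉L)
                            (∉path reached b′∉L (subst (_∉ L) (sym (mate-involutive m b)) b∉L)) ,
          inj₁ b′∈L′ ∷ inj₂ b′∈L′ ∷ weaken reached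

      closed⇒konigPair : ¬ Frontier L → KonigPair m (subset (inCover? L))
      closed⇒konigPair no-frontier = record
        { stable = ¬edge⇒stable no-edge ; unmatched∈ = unmatched∈ ; covers = covers }
        where
        closure : ∀ {a b} → a ∈ L → Edge G a b → mate m b ∈ L
        closure a∈L ab = decidable-stable (_ ∈? L) λ b′∉L → no-frontier (_ , _ , a∈L , ab , b′∉L)
        no-edge : ∀ {u v} → u ∈ subset (inCover? L) → v ∈ subset (inCover? L) → ¬ Edge G u v
        no-edge {u} {v} u∈ v∈ uv with ∈-subset⁻ (inCover? L) u∈ | ∈-subset⁻ (inCover? L) v∈
        ... | inj₁ (cu , _)   | inj₁ (cv , _)   = proper u v uv (trans cu (sym cv))
        ... | inj₁ (_ , u∈L)  | inj₂ (_ , v′∉L) = v′∉L (closure u∈L uv)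
        ... | inj₂ (_ , u′∉L) | inj₁ (_ , v∈L)  = u′∉L (closure v∈L (edge-sym uv))
        ... | inj₂ (cu , _)   | inj₂ (cv , _)   = proper u v uv (trans cu (sym cv))
        unmatched∈ : ∀ {v} → Unmatched m v → v ∈ subset (inCover? L)
        unmatched∈ {v} v-unm with c v in cv
        ... | true  = ∈-subset⁺ (inCover? L) (inj₁ (cv , roots cv v-unm))
        ... | false = ∈-subset⁺ (inCover? L)
                        (inj₂ (cv , λ v′∈L → case trans (sym (left (subst (_∈ L) v-unm v′∈L))) cv of λ ()))
        covers : ∀ {v} → Matched m v → v ∈ subset (inCover? L) ⊎ mate m v ∈ subset (inCover? L)
        covers {v} v-mat with c v in cv | v ∈? L | mate m v ∈? L
        ... | true  | yes v∈L | _ = inj₁ (∈-subset⁺ (inCover? L) (inj₁ (cv , v∈L)))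
        ... | true  | no  v∉L | _ = inj₂ (∈-subset⁺ (inCover? L)
                                      (inj₂ (proper-flip proper (mate-edge m v-mat) cv ,
                                             subst (_∉ L) (sym (mate-involutive m v)) v∉L)))
        ... | false | _ | yes v′∈L = inj₂ (∈-subset⁺ (inCover? L) (inj₁ (proper-flip proper (mate-edge m v-mat) cv , v′∈L)))
        ... | false | _ | no  v′∉L = inj₁ (∈-subset⁺ (inCover? L) (inj₂ (cv , v′∉L)))

    search : ∀ L → Acc _⊃_ L → Forest L → ∃ (KonigPair m) ⊎ ∃ (m ⊏_)
    search L (acc larger) F with frontier? L
    ... | no  no-frontier = inj₁ (_ , closed⇒konigPair F no-frontier)
    ... | yes (a , b , a∈L , ab , b′∉L) with mate m b ≟ b
    ...   | yes b-unm = inj₂ (forest-augment F a∈L ab b-unm)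
    ...   | no  b-mat = search _ (larger (x∉p⇒p⊂p∪⁅x⁆ b′∉L)) (forest-extend F a∈L ab b-mat b′∉L)

  konig : ∀ {c} → ProperColouring G c → Σ[ m ∈ Matching ] ∃ (KonigPair m)
  konig proper = go empty (⊂-wellFounded _)
    where
    go : ∀ m → Acc _⊂_ (unmatched m) → Σ[ m ∈ Matching ] ∃ (KonigPair m)
    go m (acc smaller) with Hungarian.search proper m _ (⊃-wellFounded _) (Hungarian.initialForest proper m)
    ... | inj₁ kp       = m , kp
    ... | inj₂ (q , m⊏q) = go q (smaller m⊏q)

  isAlpha-unique : ∀ {k k′} → IsAlpha G k → IsAlpha G k′ → k ≡ k′
  isAlpha-unique ((S , S-stable , refl) , S-max) ((S′ , S′-stable , refl) , S′-max) =
    ≤-antisym (S′-max S S-stable) (S-max S′ S′-stable)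

  module _ {c : Fin n → Bool} (proper : ProperColouring G c) where

    colourClass-stable : ∀ x → Stable G (colourClass c x)
    colourClass-stable x = ¬edge⇒stable λ {u} {v} u∈ v∈ uv →
      proper u v uv (trans (∈-subset⁻ (λ w → c w ≟ᵇ x) u∈) (sym (∈-subset⁻ (λ w → c w ≟ᵇ x) v∈)))

    colourClass-konigPair : ∀ {m} → Perfect m → ∀ x → KonigPair m (colourClass c x)
    colourClass-konigPair {m} perfect x = record
      { stable = colourClass-stable x ; unmatched∈ = λ {v} v-unm → contradiction v-unm (perfect v) ; covers = covers }
      where
      covers : ∀ {v} → Matched m v → v ∈ colourClass c x ⊎ mate m v ∈ colourClass c x
      covers {v} v-mat with c v ≟ᵇ x
      ... | yes cv≡x = inj₁ (∈-subset⁺ (λ w → c w ≟ᵇ x) cv≡x)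
      ... | no  cv≢x = inj₂ (∈-subset⁺ (λ w → c w ≟ᵇ x)
                              (trans (proper-flip proper (mate-edge m v-mat) (¬-not cv≢x)) (not-involutive x)))

    colourClass-isAlpha : ∀ {M} → IsPerfectMatching G M → ∀ x → IsAlpha G ∣ colourClass c x ∣
    colourClass-isAlpha pm x =
      konigPair-isAlpha (colourClass-konigPair {fromPerfectMatching pm} (fromPerfectMatching-perfect pm) x)

  αPlusStable⇒perfect : 2 ≤ n → Connected G → αPlusStable G → ∀ {m S} → KonigPair m S → Perfect m
  αPlusStable⇒perfect two connected α⁺ {m} {S} kp z z-unm =
    stable⇒¬xy T⁺-stable z∈T w′∈T
    where
    open KonigPair kp
    w = proj₁ (has-neighbour two connected z)
    zw = proj₂ (has-neighbour two connected z)
    z∈S = unmatched∈ z-unm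
    w∉S : w ∉ S
    w∉S w∈S = stable⇒¬edge stable z∈S w∈S zw
    w-mat : Matched m w
    w-mat w-unm = w∉S (unmatched∈ w-unm)
    w′∈S : mate m w ∈ S
    w′∈S = Sum.[ flip contradiction w∉S , id ]′ (covers w-mat)
    z≢w′ : z ≢ mate m w
    z≢w′ z≡w′ = edge⇒≢ zw (trans (sym z-unm) (trans (cong (mate m) z≡w′) (mate-involutive m w)))
    z≁w′ : Adj G z (mate m w) ≡ false
    z≁w′ = stable z (mate m w) z∈S w′∈S
    open AddEdge G z≢w′ z≁w′
    open Rematch m (edge-sym zw) z-unm
    maximum⁺ = proj₁ (α⁺ z (mate m w) z≢w′ z≁w′ ∣ S ∣ (konigPair-isAlpha kp))
    T⁺-stable = proj₁ (proj₂ maximum⁺)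
    ∣S∣≤∣T∣ = ≤-reflexive (sym (proj₂ (proj₂ maximum⁺)))
    z∈T = unmatched∈maximum kp (stable⁻ T⁺-stable) ∣S∣≤∣T∣ z-unm
    w′∈T = unmatched∈maximum (rematch-konigPair kp w′∈S) (stable⁻ T⁺-stable) ∣S∣≤∣T∣ (mate′-mate-a w-mat)

module _ {n} (G : Graph n) {c : Fin n → Bool} (proper : ProperColouring G c) where
  open Matchings G

  perfectMatching⇒αPlusStable : HasPerfectMatching G → αPlusStable G
  perfectMatching⇒αPlusStable (_ , pm) x y x≢y x≁y k α =
    (colourClass c x̄ , stable⁺ (colourClass-stable proper x̄) (∉-colourClass-not c x) ,
     isAlpha-unique (colourClass-isAlpha proper pm x̄) α) ,
    λ T T-stable → proj₂ α T (stable⁻ T-stable)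
    where
    open AddEdge G x≢y x≁y
    x̄ = not (c x)

  αPlusStable⇒perfectMatching : 2 ≤ n → Connected G → αPlusStable G → HasPerfectMatching G
  αPlusStable⇒perfectMatching two connected α⁺ =
    toRelation m , toRelation-isPerfectMatching {m} (αPlusStable⇒perfect two connected α⁺ kp)
    where
    m = proj₁ (konig proper)
    kp = proj₂ (proj₂ (konig proper))

  pmIntersectionEmpty⇒αMinusStable : HasPerfectMatching G → PMIntersectionEmpty G → αMinusStable G
  pmIntersectionEmpty⇒αMinusStable (_ , pm) no-common x y e k α@((S , S-stable , ∣S∣≡k) , _) =
    (S , stable⁺ S-stable , ∣S∣≡k) , bounded
    where
    open DeleteEdge G e
    avoiding⇒bounded : ∀ {M T} → IsPerfectMatching G M → M x y ≡ false → Stable G⁻ T → ∣ T ∣ ≤ k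
    avoiding⇒bounded {T = T} pm′ xy∉M T-stable =
      subst (∣ T ∣ ≤_) (isAlpha-unique (colourClass-isAlpha proper pm true) α)
        (proj₂ (Matchings.colourClass-isAlpha G⁻ (proper⁺ proper) (isPerfectMatching⁺ pm′ xy∉M) true) T T-stable)
    -- PMIntersectionEmpty yields no perfect matching avoiding xy, only the impossibility of there being
    -- none; decidability of ≤ on ℕ and of ≡ on Bool makes that sufficient.
    bounded : ∀ T → Stable G⁻ T → ∣ T ∣ ≤ k
    bounded T T-stable = decidable-stable (∣ T ∣ ≤? k) λ ∣T∣≰k →
      no-common x y λ M pm′ → decidable-stable (M x y ≟ᵇ true) λ xy∉M →
        ∣T∣≰k (avoiding⇒bounded pm′ (¬-not xy∉M) T-stable)

  αMinusStable⇒pmIntersectionEmpty : αMinusStable G → HasPerfectMatching G → PMIntersectionEmpty G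
  αMinusStable⇒pmIntersectionEmpty α⁻ (M₀ , pm₀) u v in-all =
    ¬edge-xy (proj₁ (proj₂ pm₁) u v (in-all _ (isPerfectMatching⁻ pm₁)))
    where
    e = proj₁ (proj₂ pm₀) u v (in-all M₀ pm₀)
    open DeleteEdge G e
    module G⁻ = Matchings G⁻
    konig⁻ = G⁻.konig (proper⁺ proper)
    m₁ = proj₁ konig⁻
    S₁ = proj₁ (proj₂ konig⁻)
    kp₁ = proj₂ (proj₂ konig⁻)
    m₁-perfect : G⁻.Perfect m₁
    m₁-perfect z z-unm = <⇒≱
      (G⁻.konigPair-strict kp₁ (G⁻.colourClass-stable (proper⁺ proper) (not (c z))) z-unm (∉-colourClass-not c z))
      (proj₂ (α⁻ u v e _ (colourClass-isAlpha proper pm₀ (not (c z)))) S₁ (G⁻.KonigPair.stable kp₁))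
    pm₁ = G⁻.toRelation-isPerfectMatching {m₁} m₁-perfect

proposition2 : ∀ {n} (G : Graph n) → 2 ≤ n → Connected G → Bipartite G →
    (αStable G ⇔ (HasPerfectMatching G × PMIntersectionEmpty G))
proposition2 G two connected (c , proper) = mk⇔
  (λ (α⁻ , α⁺) → let pm = αPlusStable⇒perfectMatching G proper two connected α⁺
                 in pm , αMinusStable⇒pmIntersectionEmpty G proper α⁻ pm)
  (λ (pm , no-common) → pmIntersectionEmpty⇒αMinusStable G proper pm no-common ,
                        perfectMatching⇒αPlusStable G proper pm)
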